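{- Let $p$ be a prime and $m\ge 2$, and let $\mathcal{G}$ be the set of all groups (with underlying set a subset of a fixed countable set) that are isomorphic to either $D_1=\mathbb{Z}_p^m$ or $D_2=\mathbb{Z}_p^{m-2}\times\mathbb{Z}_{p^2}$. Any deterministic algorithm that determines whether $G\in\mathcal{G}$ is isomorphic to $D_1$ or to $D_2$ must access the elements of $G$ and its Cayley table at least $\Omega(p^{m-2})=\Omega(|G|/p^2)$ times.
   Context: The algorithm accesses the group only by requesting elements of $G$ and querying the Cayley table for the product of two elements; each such access is counted. -}

module Defs where

open import Data.Nat using (ℕ; zero; suc; _+_; _*_; _∸_; _^_; _<?_)
open import Data.Nat.DivMod using (_mod_)
open import Data.Fin using (Fin; toℕ; fromℕ<)
open import Data.Fin.Properties using (any?)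
open import Data.Vec using (Vec; zipWith)
open import Data.Bool using (Bool; true; false)
open import Data.Maybe using (Maybe; just; nothing)
open import Data.Product using (Σ; _×_; _,_; ∃)
open import Relation.Binary.PropositionalEquality using (_≡_)
open import Relation.Nullary using (yes; no)
open import Function.Definitions using (Injective; Bijective)

addMod : ∀ {q} → Fin q → Fin q → Fin q
addMod {suc q} a b = (toℕ a + toℕ b) mod (suc q)

D₁ : ℕ → ℕ → Set
D₁ p m = Vec (Fin p) m

D₁-op : ∀ p m → D₁ p m → D₁ p m → D₁ p m
D₁-op p m = zipWith addMod

D₂ : ℕ → ℕ → Set
D₂ p m = Vec (Fin p) (m ∸ 2) × Fin (p ^ 2)

D₂-op : ∀ p m → D₂ p m → D₂ p m → D₂ p m
D₂-op p m (u , a) (v , b) = zipWith addMod u v , addMod a b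

-- Inputs: finite groups whose underlying set is a finite subset of the
-- fixed countable set ℕ, presented by an enumeration of the elements
-- (label : Fin size → ℕ, injective) and a Cayley table.

record LGroup : Set where
  field
    size      : ℕ
    label     : Fin size → ℕ
    label-inj : Injective _≡_ _≡_ label
    mul       : Fin size → Fin size → Fin size
open LGroup public

IsoTo : LGroup → (T : Set) → (T → T → T) → Set
IsoTo G T op = Σ (Fin (size G) → T) λ f →
  Bijective _≡_ _≡_ f × (∀ x y → f (mul G x y) ≡ op (f x) (f y))

In𝒢 : ℕ → ℕ → LGroup → Set
In𝒢 p m G = IsoTo G (D₁ p m) (D₁-op p m) ⊎' IsoTo G (D₂ p m) (D₂-op p m)
  where
  open import Data.Sum using () renaming (_⊎_ to _⊎'_)

elemOracle : (G : LGroup) → ℕ → Maybe ℕ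
elemOracle G k with k <? size G
... | yes k<n = just (label G (fromℕ< k<n))
... | no  _   = nothing

find : (G : LGroup) → ℕ → Maybe (Fin (size G))
find G a with any? (λ i → Data.Nat._≟_ (label G i) a)
  where import Data.Nat
... | yes (i , _) = just i
... | no _        = nothing

mulOracle : (G : LGroup) → ℕ → ℕ → Maybe ℕ
mulOracle G a b with find G a | find G b
... | just i | just j = just (label G (mul G i j))
... | _      | _      = nothing

-- Deterministic algorithms = (possibly infinitely branching) decision trees.
-- answer true means "G ≅ D₁", answer false means "G ≅ D₂".
data Alg : Set where
  answer  : Bool → Alg
  reqElem : ℕ → (Maybe ℕ → Alg) → Alg
  reqMul  : ℕ → ℕ → (Maybe ℕ → Alg) → Alg

run : Alg → LGroup → Bool
run (answer b)      G = b
run (reqElem k f)   G = run (f (elemOracle G k)) G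
run (reqMul a b f)  G = run (f (mulOracle G a b)) G

cost : Alg → LGroup → ℕ
cost (answer b)     G = 0
cost (reqElem k f)  G = suc (cost (f (elemOracle G k)) G)
cost (reqMul a b f) G = suc (cost (f (mulOracle G a b)) G)

Correct : ℕ → ℕ → Alg → Set
Correct p m A = ∀ G →
  (IsoTo G (D₁ p m) (D₁-op p m) → run A G ≡ true) ×
  (IsoTo G (D₂ p m) (D₂-op p m) → run A G ≡ false)

{-# OPTIONS --safe #-}
-- D₁ = ℤ_p^m and D₂ = ℤ_p^(m-2) × ℤ_(p²) share the subgroup H = ℤ_p^(m-2) of order N = p^(m-2).
-- Present both groups on the same index set, with H on the first N indices and the same
-- multiplication there.  An adversary answers each element request by a new element of H (fixing
-- the listing order only when forced to) and each Cayley-table query about a label outside H by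
-- "no such element", then moves the labels of all elements outside H beyond that label.  As long
-- as fewer than N accesses have been made, every answer is consistent with a presentation of D₁
-- and one of D₂, so a correct algorithm has to spend N accesses on the presentation of D₁.
module Submission where

open import Defs
open import Data.Bool using (true; false)
open import Data.Fin as Fin using (Fin; toℕ; fromℕ<; _↑ˡ_)
open import Data.Fin.Patterns using (0F)
open import Data.Fin.Permutation
  using (Permutation′; _⟨$⟩ʳ_; _⟨$⟩ˡ_; inverseʳ; transpose; _∘ₚ_) renaming (id to idₚ)
import Data.Fin.Permutation.Components as PC
open import Data.Fin.Properties
  using (any?; _≟_; toℕ-fromℕ<; toℕ-↑ˡ; toℕ<n; toℕ-injective; *↔×; remQuot-combine)
open import Data.Maybe using (Maybe; just; nothing)
import Data.Nat as ℕ
open import Data.Nat using (ℕ; zero; suc; _+_; _*_; _∸_; _^_; _≤_; _<_; _≥_; _≮_; _<?_; z≤n; s≤s)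
open import Data.Nat.Primality using (Prime; ¬prime[0])
open import Data.Nat.Properties
  using ( ≤-refl; ≤-trans; ≤-<-trans; ≤-reflexive; <-irrefl; <⇒≱; ≮⇒≥; n≤1+n; m≤m+n; m≤n+m; +-suc
        ; +-cancelˡ-≡; +-monoʳ-≤; *-identityˡ)
open import Data.Product using (Σ; Σ-syntax; _×_; _,_; proj₁; proj₂; uncurry)
open import Data.Product.Algebra using (×-comm)
open import Data.Product.Function.NonDependent.Propositional using (_×-↔_)
open import Data.Sum using (_⊎_; inj₁; inj₂)
import Data.Sum as Sum
open import Data.Vec using (Vec; []; _∷_)
open import Function.Bundles using (_↔_; Inverse; Injection; Bijection; mk↔ₛ′)
open import Function.Base using (_∘_)
open import Function.Construct.Composition using (_↔-∘_)
open import Function.Construct.Identity using (↔-id)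
open import Function.Definitions using (Injective)
open import Function.Properties.Inverse using (↔⇒↣; ↔⇒⤖)
open import Relation.Binary.PropositionalEquality
open import Relation.Nullary using (Dec; ¬_; yes; no; contradiction)
open import Relation.Nullary.Decidable using (dec-true; dec-false)

open Inverse using (to; from; strictlyInverseˡ; strictlyInverseʳ)
open ≡-Reasoning

module _ (G : LGroup) where

  find-label : ∀ {x a} → label G x ≡ a → find G a ≡ just x
  find-label {x} {a} x↦a with any? (λ i → label G i ℕ.≟ a)
  ... | yes (i , i↦a) = cong just (label-inj G (trans i↦a (sym x↦a)))
  ... | no unlabelled = contradiction (x , x↦a) unlabelled

  find-unlabelled : ∀ {a} → (∀ x → label G x ≢ a) → find G a ≡ nothing
  find-unlabelled {a} unlabelled with any? (λ i → label G i ℕ.≟ a)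
  ... | yes (i , i↦a) = contradiction i↦a (unlabelled i)
  ... | no _          = refl

  mulOracle-found : ∀ {a b x y} → find G a ≡ just x → find G b ≡ just y →
                    mulOracle G a b ≡ just (label G (mul G x y))
  mulOracle-found a↦x b↦y rewrite a↦x | b↦y = refl

  mulOracle-unfound : ∀ {a b} → find G a ≡ nothing ⊎ find G b ≡ nothing → mulOracle G a b ≡ nothing
  mulOracle-unfound (inj₁ a↦∅) rewrite a↦∅ = refl
  mulOracle-unfound {a} (inj₂ b↦∅) rewrite b↦∅ with find G a
  ... | just _  = refl
  ... | nothing = refl

  elemOracle-< : ∀ {k} (k<n : k < size G) → elemOracle G k ≡ just (label G (fromℕ< k<n))
  elemOracle-< {k} k<n with k <? size G
  ... | yes _   = refl
  ... | no k≮n  = contradiction k<n k≮n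

  elemOracle-≮ : ∀ {k} → k ≮ size G → elemOracle G k ≡ nothing
  elemOracle-≮ {k} k≮n with k <? size G
  ... | yes k<n = contradiction k<n k≮n
  ... | no _    = refl

data OracleCall : Alg → (LGroup → Maybe ℕ) → (Maybe ℕ → Alg) → Set where
  elemCall : ∀ k f   → OracleCall (reqElem k f) (λ G → elemOracle G k) f
  mulCall  : ∀ a b f → OracleCall (reqMul a b f) (λ G → mulOracle G a b) f

run-call : ∀ {A q f} → OracleCall A q f → ∀ G → run A G ≡ run (f (q G)) G
run-call (elemCall _ _)  _ = refl
run-call (mulCall _ _ _) _ = refl

cost-call : ∀ {A q f} → OracleCall A q f → ∀ G → cost A G ≡ suc (cost (f (q G)) G)
cost-call (elemCall _ _)  _ = refl
cost-call (mulCall _ _ _) _ = refl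

transpose-matchˡ : ∀ {n} (i j : Fin n) → PC.transpose i j i ≡ j
transpose-matchˡ i j rewrite dec-true (i ≟ i) refl = refl

transpose-fix : ∀ {n} {i j k : Fin n} → k ≢ i → k ≢ j → PC.transpose i j k ≡ k
transpose-fix {i = i} {j} {k} k≢i k≢j rewrite dec-false (k ≟ i) k≢i | dec-false (k ≟ j) k≢j = refl

cayley : ∀ {n} {T : Set} → Fin n ↔ T → (T → T → T) → Fin n → Fin n → Fin n
cayley e _·_ z w = from e (to e z · to e w)

module Presentation {N K : ℕ} where

  -- Indices below N carry the common subgroup; the offset L of the other labels is raised by the
  -- adversary past every label it has been asked about.
  labelOf : ℕ → Fin (N + K) → ℕ
  labelOf L z with toℕ z <? N
  ... | yes _ = toℕ z
  ... | no  _ = L + toℕ z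

  labelOf-< : ∀ L {z} → toℕ z < N → labelOf L z ≡ toℕ z
  labelOf-< L {z} z<N with toℕ z <? N
  ... | yes _   = refl
  ... | no z≮N  = contradiction z<N z≮N

  labelOf-↑ˡ : ∀ L i → labelOf L (i ↑ˡ K) ≡ toℕ i
  labelOf-↑ˡ L i = trans (labelOf-< L (subst (_< N) (sym (toℕ-↑ˡ i K)) (toℕ<n i))) (toℕ-↑ˡ i K)

  shift-≮ : ∀ L {n} → n ≮ N → L + n ≮ N
  shift-≮ L {n} n≮N L+n<N = n≮N (≤-<-trans (m≤n+m n L) L+n<N)

  labelOf-injective : ∀ L → Injective _≡_ _≡_ (labelOf L)
  labelOf-injective L {z} {w} eq with toℕ z <? N | toℕ w <? N
  ... | yes _   | yes _   = toℕ-injective eq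
  ... | no _    | no _    = toℕ-injective (+-cancelˡ-≡ L _ _ eq)
  ... | yes z<N | no w≮N  = contradiction (subst (_< N) eq z<N) (shift-≮ L w≮N)
  ... | no z≮N  | yes w<N = contradiction (subst (_< N) (sym eq) w<N) (shift-≮ L z≮N)

  labelOf-avoids : ∀ {L a} → N ≤ a → a < L → ∀ z → labelOf L z ≢ a
  labelOf-avoids {L} N≤a a<L z z↦a with toℕ z <? N
  ... | yes z<N = <⇒≱ (subst (_< N) z↦a z<N) N≤a
  ... | no _    = <⇒≱ a<L (≤-trans (m≤m+n L _) (≤-reflexive z↦a))

  present : (Fin (N + K) → Fin (N + K) → Fin (N + K)) → Permutation′ (N + K) → ℕ → LGroup
  present μ π L = record
    { size      = N + K
    ; label     = λ x → labelOf L (π ⟨$⟩ʳ x)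
    ; label-inj = λ eq → Injection.injective (↔⇒↣ π) (labelOf-injective L eq)
    ; mul       = λ x y → π ⟨$⟩ˡ μ (π ⟨$⟩ʳ x) (π ⟨$⟩ʳ y)
    }

  present-iso : ∀ {T} (op : T → T → T) (e : Fin (N + K) ↔ T) π L →
                IsoTo (present (cayley e op) π L) T op
  present-iso op e π L = to (e ↔-∘ π) , Bijection.bijective (↔⇒⤖ (e ↔-∘ π)) , λ _ _ →
    trans (cong (to e) (inverseʳ π)) (strictlyInverseˡ e _)

  find-low : ∀ μ π L {a} (a<N : a < N) → find (present μ π L) a ≡ just (π ⟨$⟩ˡ (fromℕ< a<N ↑ˡ K))
  find-low μ π L {a} a<N = find-label (present μ π L) (begin
    labelOf L (π ⟨$⟩ʳ (π ⟨$⟩ˡ (fromℕ< a<N ↑ˡ K))) ≡⟨ cong (labelOf L) (inverseʳ π) ⟩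
    labelOf L (fromℕ< a<N ↑ˡ K)                   ≡⟨ labelOf-↑ˡ L _ ⟩
    toℕ (fromℕ< a<N)                               ≡⟨ toℕ-fromℕ< a<N ⟩
    a                                              ∎)

  mulOracle-outside : ∀ μ π L {a c} → N ≤ a ⊎ N ≤ c → a + c < L → mulOracle (present μ π L) a c ≡ nothing
  mulOracle-outside μ π L {a} {c} outside a+c<L = mulOracle-unfound G (Sum.map
    (λ N≤a → find-unlabelled G λ x → labelOf-avoids N≤a (≤-trans (s≤s (m≤m+n a c)) a+c<L) (π ⟨$⟩ʳ x))
    (λ N≤c → find-unlabelled G λ x → labelOf-avoids N≤c (≤-trans (s≤s (m≤n+m c a)) a+c<L) (π ⟨$⟩ʳ x))
    outside)
    where G = present μ π L

module Adversary {N K : ℕ} (_∙_ : Fin N → Fin N → Fin N) where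
  open Presentation {N} {K}

  Extends : (Fin (N + K) → Fin (N + K) → Fin (N + K)) → Set
  Extends μ = ∀ i i' → μ (i ↑ˡ K) (i' ↑ˡ K) ≡ (i ∙ i') ↑ˡ K

  PrefixHomomorphism : {T : Set} → Fin (N + K) ↔ T → (T → T → T) → Set
  PrefixHomomorphism e op = ∀ i i' → op (to e (i ↑ˡ K)) (to e (i' ↑ˡ K)) ≡ to e ((i ∙ i') ↑ˡ K)

  cayley-extends : ∀ {T} (op : T → T → T) (e : Fin (N + K) ↔ T) →
                   PrefixHomomorphism e op → Extends (cayley e op)
  cayley-extends op e hom i i' = trans (cong (from e) (hom i i')) (strictlyInverseʳ e _)

  mulOracle-low : ∀ μ π L {a c} → Extends μ → (a<N : a < N) (c<N : c < N) →
                  mulOracle (present μ π L) a c ≡ just (toℕ (fromℕ< a<N ∙ fromℕ< c<N))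
  mulOracle-low μ π L {a} {c} ext a<N c<N = begin
    mulOracle (present μ π L) a c
      ≡⟨ mulOracle-found _ (find-low μ π L a<N) (find-low μ π L c<N) ⟩
    just (labelOf L (π ⟨$⟩ʳ (π ⟨$⟩ˡ μ (π ⟨$⟩ʳ (π ⟨$⟩ˡ (i ↑ˡ K))) (π ⟨$⟩ʳ (π ⟨$⟩ˡ (i' ↑ˡ K))))))
      ≡⟨ cong (just ∘ labelOf L) (trans (inverseʳ π) (cong₂ μ (inverseʳ π) (inverseʳ π))) ⟩
    just (labelOf L (μ (i ↑ˡ K) (i' ↑ˡ K)))
      ≡⟨ cong (just ∘ labelOf L) (ext i i') ⟩
    just (labelOf L ((i ∙ i') ↑ˡ K))
      ≡⟨ cong just (labelOf-↑ˡ L (i ∙ i')) ⟩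
    just (toℕ (i ∙ i'))
      ∎
    where
    i  = fromℕ< a<N
    i' = fromℕ< c<N

  record State : Set where
    constructor state
    field
      order    : Permutation′ (N + K)
      revealed : ℕ
      offset   : ℕ
  open State

  presentation : (Fin (N + K) → Fin (N + K) → Fin (N + K)) → State → LGroup
  presentation μ σ = present μ (order σ) (offset σ)

  Revealed : State → Fin (N + K) → Set
  Revealed σ x = toℕ (order σ ⟨$⟩ʳ x) < revealed σ

  revealed? : ∀ σ x → Dec (Revealed σ x)
  revealed? σ x = toℕ (order σ ⟨$⟩ʳ x) <? revealed σ

  -- Refinement keeps earlier answers valid: revealed elements keep their positions, and labels
  -- refused so far stay below the offset.
  record _⊑_ (σ σ' : State) : Set where
    field
      fixes-revealed : ∀ {x} → Revealed σ x → order σ' ⟨$⟩ʳ x ≡ order σ ⟨$⟩ʳ x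
      revealed-mono  : revealed σ ≤ revealed σ'
      offset-mono    : offset σ ≤ offset σ'
  open _⊑_

  ⊑-refl : ∀ {σ} → σ ⊑ σ
  ⊑-refl = record { fixes-revealed = λ _ → refl ; revealed-mono = ≤-refl ; offset-mono = ≤-refl }

  ⊑-trans : ∀ {σ σ' σ''} → σ ⊑ σ' → σ' ⊑ σ'' → σ ⊑ σ''
  ⊑-trans {σ} {σ'} σ⊑σ' σ'⊑σ'' = record
    { fixes-revealed = λ rev → trans (fixes-revealed σ'⊑σ'' (still-revealed rev)) (fixes-revealed σ⊑σ' rev)
    ; revealed-mono  = ≤-trans (revealed-mono σ⊑σ') (revealed-mono σ'⊑σ'')
    ; offset-mono    = ≤-trans (offset-mono σ⊑σ') (offset-mono σ'⊑σ'')
    }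
    where
    still-revealed : ∀ {x} → Revealed σ x → Revealed σ' x
    still-revealed rev = subst (λ z → toℕ z < revealed σ') (sym (fixes-revealed σ⊑σ' rev))
                               (≤-trans rev (revealed-mono σ⊑σ'))

  labelOf-revealed : ∀ {σ σ' x} → revealed σ ≤ N → σ ⊑ σ' → Revealed σ x →
                     labelOf (offset σ') (order σ' ⟨$⟩ʳ x) ≡ toℕ (order σ ⟨$⟩ʳ x)
  labelOf-revealed j≤N σ⊑σ' rev =
    trans (cong (labelOf _) (fixes-revealed σ⊑σ' rev)) (labelOf-< _ (≤-trans rev j≤N))

  fresh : ∀ {j} → j < N → Fin (N + K)
  fresh j<N = fromℕ< j<N ↑ˡ K

  toℕ-fresh : ∀ {j} (j<N : j < N) → toℕ (fresh j<N) ≡ j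
  toℕ-fresh j<N = trans (toℕ-↑ˡ _ K) (toℕ-fromℕ< j<N)

  reveal : (σ : State) → Fin (N + K) → revealed σ < N → State
  reveal σ x j<N =
    state (order σ ∘ₚ transpose (order σ ⟨$⟩ʳ x) (fresh j<N)) (suc (revealed σ)) (offset σ)

  reveal-sends : ∀ σ x (j<N : revealed σ < N) → order (reveal σ x j<N) ⟨$⟩ʳ x ≡ fresh j<N
  reveal-sends σ x j<N = transpose-matchˡ (order σ ⟨$⟩ʳ x) (fresh j<N)

  reveal-revealed : ∀ σ x (j<N : revealed σ < N) → Revealed (reveal σ x j<N) x
  reveal-revealed σ x j<N =
    subst (_< suc (revealed σ)) (sym (trans (cong toℕ (reveal-sends σ x j<N)) (toℕ-fresh j<N))) ≤-refl

  reveal-extends : ∀ {σ x} (j<N : revealed σ < N) → ¬ Revealed σ x → σ ⊑ reveal σ x j<N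
  reveal-extends {σ} j<N unrevealed = record
    { fixes-revealed = λ rev → transpose-fix
        (λ y≡x → unrevealed (subst (λ z → toℕ z < revealed σ) y≡x rev))
        (λ y≡t → <-irrefl (toℕ-fresh j<N) (subst (λ z → toℕ z < revealed σ) y≡t rev))
    ; revealed-mono  = n≤1+n _
    ; offset-mono    = ≤-refl
    }

  Forces : State → (LGroup → Maybe ℕ) → Maybe ℕ → Set
  Forces σ q r = ∀ {σ'} → σ ⊑ σ' → ∀ μ → Extends μ → q (presentation μ σ') ≡ r

  Indistinguishable : Alg → State → Set
  Indistinguishable A σ = ∀ μ μ' → Extends μ → Extends μ' →
                          run A (presentation μ σ) ≡ run A (presentation μ' σ)

  CostsAtLeast : ℕ → Alg → State → Set
  CostsAtLeast b A σ = ∀ μ → Extends μ → b ≤ cost A (presentation μ σ)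

  Outcome : Alg → State → ℕ → Set
  Outcome A σ b = Σ[ σ' ∈ State ] σ ⊑ σ' × (Indistinguishable A σ' ⊎ CostsAtLeast b A σ')

  record Reply (σ : State) (q : LGroup → Maybe ℕ) (b : ℕ) : Set where
    field
      next          : State
      reply         : Maybe ℕ
      extends       : σ ⊑ next
      forces        : Forces next q reply
      within-budget : revealed next + b ≤ N
  open Reply

  step : ∀ {A q f σ b} → OracleCall A q f → (r : Reply σ q b) →
         Outcome (f (reply r)) (next r) b → Outcome A σ (suc b)
  step {A} {q} {f} call r (σ' , next⊑σ' , result) = σ' , ⊑-trans (extends r) next⊑σ' , Sum.map
      (λ same μ μ' ext ext' → trans (run-forced μ ext) (trans (same μ μ' ext ext') (sym (run-forced μ' ext'))))
      (λ costly μ ext → ≤-trans (s≤s (costly μ ext)) (≤-reflexive (sym (cost-forced μ ext))))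
      result
    where
    run-forced : ∀ μ → Extends μ → run A (presentation μ σ') ≡ run (f (reply r)) (presentation μ σ')
    run-forced μ ext = trans (run-call call _) (cong (λ o → run (f o) _) (forces r next⊑σ' μ ext))
    cost-forced : ∀ μ → Extends μ →
                  cost A (presentation μ σ') ≡ suc (cost (f (reply r)) (presentation μ σ'))
    cost-forced μ ext = trans (cost-call call _) (cong (λ o → suc (cost (f o) _)) (forces r next⊑σ' μ ext))

  spend : ∀ {j b} → j + suc b ≤ N → j + b ≤ N
  spend {j} {b} budget = ≤-trans (+-monoʳ-≤ j (n≤1+n b)) budget

  stayReply : ∀ {σ q b} r → Forces σ q r → revealed σ + suc b ≤ N → Reply σ q b
  stayReply {σ} r forced budget = record
    { next = σ ; reply = r ; extends = ⊑-refl ; forces = forced ; within-budget = spend budget }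

  revealedReply : ∀ σ {k b} (k<s : k < N + K) → Revealed σ (fromℕ< k<s) → revealed σ + suc b ≤ N →
                  Reply σ (λ G → elemOracle G k) b
  revealedReply σ {b = b} k<s rev budget = stayReply (just (toℕ (order σ ⟨$⟩ʳ fromℕ< k<s)))
    (λ {σ'} σ⊑σ' μ _ → trans (elemOracle-< (presentation μ σ') k<s)
                             (cong just (labelOf-revealed (≤-trans (m≤m+n _ (suc b)) budget) σ⊑σ' rev)))
    budget

  freshReply : ∀ σ {k b} (k<s : k < N + K) → ¬ Revealed σ (fromℕ< k<s) → revealed σ + suc b ≤ N →
               Reply σ (λ G → elemOracle G k) b
  freshReply σ {b = b} k<s unrevealed budget = record
    { next          = σ₁
    ; reply         = just (revealed σ)
    ; extends       = reveal-extends j<N unrevealed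
    ; forces        = λ {σ'} σ₁⊑σ' μ _ → trans (elemOracle-< (presentation μ σ') k<s) (cong just (begin
        labelOf (offset σ') (order σ' ⟨$⟩ʳ x) ≡⟨ labelOf-revealed j<N σ₁⊑σ' (reveal-revealed σ x j<N) ⟩
        toℕ (order σ₁ ⟨$⟩ʳ x)                 ≡⟨ cong toℕ (reveal-sends σ x j<N) ⟩
        toℕ (fresh j<N)                       ≡⟨ toℕ-fresh j<N ⟩
        revealed σ                            ∎))
    ; within-budget = budget′
    }
    where
    x = fromℕ< k<s
    budget′ : suc (revealed σ) + b ≤ N
    budget′ = subst (_≤ N) (+-suc _ b) budget
    j<N : revealed σ < N
    j<N = ≤-trans (s≤s (m≤m+n _ b)) budget′
    σ₁ = reveal σ x j<N

  elementReply : ∀ σ k {b} → revealed σ + suc b ≤ N → Reply σ (λ G → elemOracle G k) b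
  elementReply σ k budget with k <? N + K
  ... | no k≮s = stayReply nothing (λ {σ'} _ μ _ → elemOracle-≮ (presentation μ σ') k≮s) budget
  ... | yes k<s with revealed? σ (fromℕ< k<s)
  ...   | yes rev        = revealedReply σ k<s rev budget
  ...   | no unrevealed  = freshReply σ k<s unrevealed budget

  outsideReply : ∀ σ a c {b} → N ≤ a ⊎ N ≤ c → revealed σ + suc b ≤ N →
                 Reply σ (λ G → mulOracle G a c) b
  outsideReply σ a c outside budget = record
    { next          = state (order σ) (revealed σ) (suc (a + c) + offset σ)
    ; reply         = nothing
    ; extends       = record { fixes-revealed = λ _ → refl ; revealed-mono = ≤-refl ; offset-mono = m≤n+m _ _ }
    ; forces        = λ {σ'} σ₁⊑σ' μ _ → mulOracle-outside μ (order σ') (offset σ') outside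
                                           (≤-trans (s≤s (m≤m+n (a + c) _)) (offset-mono σ₁⊑σ'))
    ; within-budget = spend budget
    }

  mulReply : ∀ σ a c {b} → revealed σ + suc b ≤ N → Reply σ (λ G → mulOracle G a c) b
  mulReply σ a c budget with a <? N | c <? N
  ... | yes a<N | yes c<N = stayReply (just (toℕ (fromℕ< a<N ∙ fromℕ< c<N)))
                              (λ {σ'} _ μ ext → mulOracle-low μ (order σ') (offset σ') ext a<N c<N) budget
  ... | no a≮N  | _       = outsideReply σ a c (inj₁ (≮⇒≥ a≮N)) budget
  ... | yes _   | no c≮N  = outsideReply σ a c (inj₂ (≮⇒≥ c≮N)) budget

  adversary : ∀ A σ b → revealed σ + b ≤ N → Outcome A σ b
  adversary A              σ zero    _      = σ , ⊑-refl , inj₂ (λ _ _ → z≤n)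
  adversary (answer _)     σ (suc b) _      = σ , ⊑-refl , inj₁ (λ _ _ _ _ → refl)
  adversary (reqElem k f)  σ (suc b) budget =
    let r = elementReply σ k budget in
    step (elemCall k f) r (adversary (f (reply r)) (next r) b (within-budget r))
  adversary (reqMul a c f) σ (suc b) budget =
    let r = mulReply σ a c budget in
    step (mulCall a c f) r (adversary (f (reply r)) (next r) b (within-budget r))

  distinguishing-cost : ∀ {T₁ T₂ : Set} (op₁ : T₁ → T₁ → T₁) (op₂ : T₂ → T₂ → T₂)
                        (e₁ : Fin (N + K) ↔ T₁) (e₂ : Fin (N + K) ↔ T₂) →
                        PrefixHomomorphism e₁ op₁ → PrefixHomomorphism e₂ op₂ → (A : Alg) →
                        (∀ G → (IsoTo G T₁ op₁ → run A G ≡ true) × (IsoTo G T₂ op₂ → run A G ≡ false)) →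
                        Σ LGroup λ G → IsoTo G T₁ op₁ × N ≤ cost A G
  distinguishing-cost op₁ op₂ e₁ e₂ hom₁ hom₂ A correct with adversary A (state idₚ 0 0) N ≤-refl
  ... | σ , _ , inj₁ same = contradiction (begin
        true      ≡⟨ sym (proj₁ (correct G₁) (present-iso op₁ e₁ (order σ) (offset σ))) ⟩
        run A G₁  ≡⟨ same μ₁ μ₂ (cayley-extends op₁ e₁ hom₁) (cayley-extends op₂ e₂ hom₂) ⟩
        run A G₂  ≡⟨ proj₂ (correct G₂) (present-iso op₂ e₂ (order σ) (offset σ)) ⟩
        false     ∎) λ ()
    where
    μ₁ = cayley e₁ op₁
    μ₂ = cayley e₂ op₂
    G₁ = presentation μ₁ σ
    G₂ = presentation μ₂ σ
  ... | σ , _ , inj₂ costly = presentation (cayley e₁ op₁) σ , present-iso op₁ e₁ (order σ) (offset σ) ,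
                              costly (cayley e₁ op₁) (cayley-extends op₁ e₁ hom₁)

∷↔ : ∀ {A : Set} {n} → (A × Vec A n) ↔ Vec A (suc n)
∷↔ = mk↔ₛ′ (uncurry _∷_) (λ { (x ∷ xs) → x , xs }) (λ { (x ∷ xs) → refl }) (λ _ → refl)

++²↔ : ∀ {A : Set} {n} → (Vec A 2 × Vec A n) ↔ Vec A (2 + n)
++²↔ = mk↔ₛ′ (λ { (x ∷ y ∷ [] , v) → x ∷ y ∷ v }) (λ { (x ∷ y ∷ v) → x ∷ y ∷ [] , v })
             (λ { (x ∷ y ∷ v) → refl }) (λ { (x ∷ y ∷ [] , v) → refl })

^↔Vec : ∀ {n} k → Fin (n ^ k) ↔ Vec (Fin n) k
^↔Vec zero        = mk↔ₛ′ (λ _ → []) (λ _ → 0F) (λ { [] → refl }) (λ { 0F → refl ; (Fin.suc ()) })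
^↔Vec {n} (suc k) = ∷↔ ↔-∘ ((↔-id _ ×-↔ ^↔Vec k) ↔-∘ *↔× {n} {n ^ k})

module D₁-D₂ (p₁ m : ℕ) where
  P = suc p₁
  N = P ^ m
  -- N + K is then P ^ 2 * N by computation, since P ^ 2 reduces to a successor.
  K = ℕ.pred (P ^ 2) * N

  digits : Fin N ↔ Vec (Fin P) m
  digits = ^↔Vec m

  _∙_ : Fin N → Fin N → Fin N
  i ∙ i' = from digits (D₁-op P m (to digits i) (to digits i'))

  e₁ : Fin (N + K) ↔ D₁ P (2 + m)
  e₁ = ++²↔ ↔-∘ ((^↔Vec 2 ×-↔ digits) ↔-∘ *↔×)

  e₂ : Fin (N + K) ↔ D₂ P (2 + m)
  e₂ = (digits ×-↔ ↔-id _) ↔-∘ (×-comm _ _ ↔-∘ *↔×)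

  e₁-↑ˡ : ∀ i → to e₁ (i ↑ˡ K) ≡ 0F ∷ 0F ∷ to digits i
  e₁-↑ˡ i = cong (to (++²↔ ↔-∘ (^↔Vec 2 ×-↔ digits))) (remQuot-combine 0F i)

  e₂-↑ˡ : ∀ i → to e₂ (i ↑ˡ K) ≡ (to digits i , 0F)
  e₂-↑ˡ i = cong (to ((digits ×-↔ ↔-id _) ↔-∘ ×-comm _ _)) (remQuot-combine 0F i)

  open Adversary {N} {K} _∙_ using (PrefixHomomorphism; distinguishing-cost)

  e₁-hom : PrefixHomomorphism e₁ (D₁-op P (2 + m))
  e₁-hom i i' = begin
    D₁-op P (2 + m) (to e₁ (i ↑ˡ K)) (to e₁ (i' ↑ˡ K)) ≡⟨ cong₂ (D₁-op P (2 + m)) (e₁-↑ˡ i) (e₁-↑ˡ i') ⟩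
    0F ∷ 0F ∷ D₁-op P m (to digits i) (to digits i')   ≡⟨ cong (λ v → 0F ∷ 0F ∷ v) (sym (strictlyInverseˡ digits _)) ⟩
    0F ∷ 0F ∷ to digits (i ∙ i')                       ≡⟨ sym (e₁-↑ˡ (i ∙ i')) ⟩
    to e₁ ((i ∙ i') ↑ˡ K)                              ∎

  e₂-hom : PrefixHomomorphism e₂ (D₂-op P (2 + m))
  e₂-hom i i' = begin
    D₂-op P (2 + m) (to e₂ (i ↑ˡ K)) (to e₂ (i' ↑ˡ K)) ≡⟨ cong₂ (D₂-op P (2 + m)) (e₂-↑ˡ i) (e₂-↑ˡ i') ⟩
    (D₁-op P m (to digits i) (to digits i') , 0F)      ≡⟨ cong (_, 0F) (sym (strictlyInverseˡ digits _)) ⟩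
    (to digits (i ∙ i') , 0F)                          ≡⟨ sym (e₂-↑ˡ (i ∙ i')) ⟩
    to e₂ ((i ∙ i') ↑ˡ K)                              ∎

  lowerBound : (A : Alg) → Correct P (2 + m) A → Σ LGroup λ G → In𝒢 P (2 + m) G × N ≤ cost A G
  lowerBound A correct with distinguishing-cost (D₁-op P (2 + m)) (D₂-op P (2 + m)) e₁ e₂ e₁-hom e₂-hom A correct
  ... | G , G≅D₁ , N≤cost = G , inj₁ G≅D₁ , N≤cost

mainTheorem20 : Σ ℕ λ c → 1 ≤ c × (∀ p m → Prime p → m ≥ 2 → (A : Alg) → Correct p m A →
                  Σ LGroup λ G → In𝒢 p m G × p ^ (m ∸ 2) ≤ c * cost A G)
mainTheorem20 = 1 , ≤-refl , bound
  where
  bound : ∀ p m → Prime p → m ≥ 2 → (A : Alg) → Correct p m A →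
          Σ LGroup λ G → In𝒢 p m G × p ^ (m ∸ 2) ≤ 1 * cost A G
  bound zero     _             0-prime _           = contradiction 0-prime ¬prime[0]
  bound (suc _)  (suc zero)    _       (s≤s ())
  bound (suc p₁) (suc (suc m)) _       _ A correct with D₁-D₂.lowerBound p₁ m A correct
  ... | G , G∈𝒢 , N≤cost = G , G∈𝒢 , subst (_ ≤_) (sym (*-identityˡ _)) N≤cost
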